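{- Let $E$ be a low-defect expression with low-defect tree $T$. For variables $x,y$ of $E$, we have $x\preceq y$ in the nesting ordering of $E$ if and only if the vertex of $T$ corresponding to $x$ is a descendant (possibly equal) of the vertex of $T$ corresponding to $y$.
   Context: Low-defect expressions: (a) every positive integer constant is one; (b) the product of two low-defect expressions with disjoint variable sets is one; (c) if $E$ is one, $c$ a positive integer and $x$ a variable not in $E$, then $E\cdot x+c$ is one. Nesting ordering: $x\preceq y$ iff $x$ appears in the smallest low-defect subexpression of $E$ containing $y$. The low-defect tree $T$ of $E$ (rooted, vertices and edges labeled by positive integers): for a constant $n$, a single vertex labeled $n$; for $E=E'\cdot x+c$ with tree $T'$, $T'$ with a new root labeled $1$ joined to the root of $T'$ by an edge labeled $c$; for $E=E_1\cdot E_2$ with trees $T_1,T_2$, remove both roots and add a new root labeled by the product of the old root labels, adjacent to all vertices previously adjacent to either old root, edge labels kept. Variables correspond to non-root vertices: for $E=E'\cdot x+c$, variables of $E'$ correspond as in $T'$ and $x$ corresponds to the root of $T'$; for $E=E_1\cdot E_2$, variables of each $E_j$ correspond as in $T_j$. -}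

module Defs where

open import Data.Nat using (ℕ; zero; suc; _+_; _*_; _≤_)
open import Data.Product using (Σ; _×_; _,_; ∃)
open import Data.List using (List; []; _∷_; _++_; length)
open import Data.List.Membership.Propositional using (_∈_; _∉_)
open import Data.List.Relation.Binary.Disjoint.Propositional using (Disjoint)
open import Relation.Binary.PropositionalEquality using (_≡_)

Var : Set
Var = ℕ

-- Formal expressions built by the three formation rules.
--   const n      : the constant n
--   E ⊗ F        : the product E · F
--   lin E x c    : E · x + c
data Expr : Set where
  const : ℕ → Expr
  _⊗_   : Expr → Expr → Expr
  lin   : Expr → Var → ℕ → Expr

vars : Expr → List Var
vars (const n)   = []
vars (E ⊗ F)     = vars E ++ vars F
vars (lin E x c) = x ∷ vars E

data LowDefect : Expr → Set where
  ld-const : ∀ {n} → 1 ≤ n → LowDefect (const n)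
  ld-mul   : ∀ {E F} → LowDefect E → LowDefect F →
             Disjoint (vars E) (vars F) → LowDefect (E ⊗ F)
  ld-lin   : ∀ {E x c} → LowDefect E → x ∉ vars E → 1 ≤ c →
             LowDefect (lin E x c)

data _⊑_ : Expr → Expr → Set where
  ⊑-refl : ∀ {E} → E ⊑ E
  ⊑-mulˡ : ∀ {F E₁ E₂} → F ⊑ E₁ → F ⊑ (E₁ ⊗ E₂)
  ⊑-mulʳ : ∀ {F E₁ E₂} → F ⊑ E₂ → F ⊑ (E₁ ⊗ E₂)
  ⊑-lin  : ∀ {F E x c} → F ⊑ E → F ⊑ lin E x c

IsSmallestLDSubContaining : Expr → Var → Expr → Set
IsSmallestLDSubContaining E y F =
  F ⊑ E × LowDefect F × y ∈ vars F ×
  (∀ G → G ⊑ E → LowDefect G → y ∈ vars G → F ⊑ G)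

_≼[_]_ : Var → Expr → Var → Set
x ≼[ E ] y = Σ Expr λ F → IsSmallestLDSubContaining E y F × x ∈ vars F

-- Rooted trees, vertices and edges labelled by naturals:
-- a node has a label and a list of (edge label , subtree).
data Tree : Set where
  node : ℕ → List (ℕ × Tree) → Tree

label : Tree → ℕ
label (node a _) = a

children : Tree → List (ℕ × Tree)
children (node _ cs) = cs

tree : Expr → Tree
tree (const n)   = node n []
tree (lin E x c) = node 1 ((c , tree E) ∷ [])
tree (E ⊗ F)     = node (label (tree E) * label (tree F))
                        (children (tree E) ++ children (tree F))

-- Vertices of a tree are addressed by paths from the root: a list of
-- child indices (0-based, in the order of the children list).
Path : Set
Path = List ℕ

data Corr : Expr → Var → Path → Set where
  corr-new  : ∀ {E x c} → Corr (lin E x c) x (0 ∷ [])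
  corr-old  : ∀ {E x c z p} → Corr E z p → Corr (lin E x c) z (0 ∷ p)
  corr-mulˡ : ∀ {E F z i p} → Corr E z (i ∷ p) → Corr (E ⊗ F) z (i ∷ p)
  corr-mulʳ : ∀ {E F z i p} → Corr F z (i ∷ p) →
              Corr (E ⊗ F) z (length (children (tree E)) + i ∷ p)

DescendantOf : Path → Path → Set
DescendantOf p q = ∃ λ r → q ++ r ≡ p

-- The variable y with tree vertex q is introduced by a unique subexpression
-- E'·y+c of E, its scope. Freshness of y and disjointness of factors force
-- every low-defect subexpression containing y to contain the scope, so the
-- scope is the smallest one; and by construction of the tree its variables
-- are exactly those sitting at descendants of q.
module Submission where

open import Defs
open import Data.Empty using (⊥-elim)
open import Data.List using ([]; _∷_; length)
open import Data.List.Membership.Propositional using (_∈_)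
open import Data.List.Membership.Propositional.Properties using (∈-++⁺ˡ; ∈-++⁺ʳ)
open import Data.List.Properties using (length-++; ∷-injective; ∷-injectiveˡ; ∷-injectiveʳ; ++-conicalˡ)
open import Data.List.Relation.Unary.Any using (here; there)
open import Data.Nat using (_+_; _<_; s≤s; z≤n)
open import Data.Nat.Properties using (≤-trans; m≤m+n; +-monoʳ-<; +-cancelˡ-≡; m+n≮m)
open import Data.Product using (_,_; map₂)
open import Function.Bundles using (_⇔_; mk⇔)
open import Relation.Binary.PropositionalEquality using (_≢_; refl; sym; cong; cong₂; subst)
open import Relation.Nullary using (¬_)

⊑-vars : ∀ {F E x} → F ⊑ E → x ∈ vars F → x ∈ vars E
⊑-vars ⊑-refl                   x∈ = x∈
⊑-vars (⊑-mulˡ F⊑)              x∈ = ∈-++⁺ˡ (⊑-vars F⊑ x∈)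
⊑-vars {E = E₁ ⊗ _} (⊑-mulʳ F⊑) x∈ = ∈-++⁺ʳ (vars E₁) (⊑-vars F⊑ x∈)
⊑-vars (⊑-lin F⊑)               x∈ = there (⊑-vars F⊑ x∈)

⊑-lowDefect : ∀ {F E} → LowDefect E → F ⊑ E → LowDefect F
⊑-lowDefect ld                ⊑-refl      = ld
⊑-lowDefect (ld-mul ldE₁ _ _) (⊑-mulˡ F⊑) = ⊑-lowDefect ldE₁ F⊑
⊑-lowDefect (ld-mul _ ldE₂ _) (⊑-mulʳ F⊑) = ⊑-lowDefect ldE₂ F⊑
⊑-lowDefect (ld-lin ldE _ _)  (⊑-lin F⊑)  = ⊑-lowDefect ldE F⊑

corr-vars : ∀ {E x p} → Corr E x p → x ∈ vars E
corr-vars corr-new                   = here refl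
corr-vars (corr-old cx)              = there (corr-vars cx)
corr-vars (corr-mulˡ cx)             = ∈-++⁺ˡ (corr-vars cx)
corr-vars {E = E ⊗ _} (corr-mulʳ cx) = ∈-++⁺ʳ (vars E) (corr-vars cx)

corr-nonempty : ∀ {E x} → ¬ Corr E x []
corr-nonempty ()

corr-head<children : ∀ {E x i p} → Corr E x (i ∷ p) → i < length (children (tree E))
corr-head<children corr-new     = s≤s z≤n
corr-head<children (corr-old _) = s≤s z≤n
corr-head<children {E = A ⊗ _} (corr-mulˡ cx) =
  subst (_ <_) (sym (length-++ (children (tree A))))
    (≤-trans (corr-head<children cx) (m≤m+n _ _))
corr-head<children {E = A ⊗ _} (corr-mulʳ cx) =
  subst (_ <_) (sym (length-++ (children (tree A))))
    (+-monoʳ-< (length (children (tree A))) (corr-head<children cx))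

corr-head≢shifted : ∀ {E x i j p} → Corr E x (i ∷ p) →
                    length (children (tree E)) + j ≢ i
corr-head≢shifted {j = j} cx eq =
  m+n≮m _ j (subst (_< _) (sym eq) (corr-head<children cx))

∷-descendant : ∀ {i p q} → DescendantOf p q → DescendantOf (i ∷ p) (i ∷ q)
∷-descendant = map₂ (cong (_ ∷_))

∷-descendant⁻ : ∀ {i j p q} → DescendantOf (i ∷ p) (j ∷ q) → DescendantOf p q
∷-descendant⁻ = map₂ ∷-injectiveʳ

descendant-shift : ∀ n {i j p q} → DescendantOf (i ∷ p) (j ∷ q) →
                   DescendantOf (n + i ∷ p) (n + j ∷ q)
descendant-shift n (r , refl) = r , refl

descendant-unshift : ∀ n {i j p q} → DescendantOf (n + i ∷ p) (n + j ∷ q) →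
                     DescendantOf (i ∷ p) (j ∷ q)
descendant-unshift n (r , eq) with ∷-injective eq
... | n+j≡n+i , q++r≡p = r , cong₂ _∷_ (+-cancelˡ-≡ n _ _ n+j≡n+i) q++r≡p

scope : ∀ {E y q} → Corr E y q → Expr
scope (corr-new {E} {x} {c}) = lin E x c
scope (corr-old cy)          = scope cy
scope (corr-mulˡ cy)         = scope cy
scope (corr-mulʳ cy)         = scope cy

scope-⊑ : ∀ {E y q} (cy : Corr E y q) → scope cy ⊑ E
scope-⊑ corr-new       = ⊑-refl
scope-⊑ (corr-old cy)  = ⊑-lin (scope-⊑ cy)
scope-⊑ (corr-mulˡ cy) = ⊑-mulˡ (scope-⊑ cy)
scope-⊑ (corr-mulʳ cy) = ⊑-mulʳ (scope-⊑ cy)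

∈-scope : ∀ {E y q} (cy : Corr E y q) → y ∈ vars (scope cy)
∈-scope corr-new       = here refl
∈-scope (corr-old cy)  = ∈-scope cy
∈-scope (corr-mulˡ cy) = ∈-scope cy
∈-scope (corr-mulʳ cy) = ∈-scope cy

scope-vars : ∀ {E y q} (cy : Corr E y q) {x} → x ∈ vars (scope cy) → x ∈ vars E
scope-vars cy = ⊑-vars (scope-⊑ cy)

scope-minimal : ∀ {E y q} → LowDefect E → (cy : Corr E y q) →
                ∀ G → G ⊑ E → y ∈ vars G → scope cy ⊑ G
scope-minimal _ corr-new _ ⊑-refl _ = ⊑-refl
scope-minimal (ld-lin _ y∉ _) corr-new G (⊑-lin G⊑) y∈G = ⊥-elim (y∉ (⊑-vars G⊑ y∈G))
scope-minimal _ (corr-old cy) _ ⊑-refl _ = scope-⊑ (corr-old cy)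
scope-minimal (ld-lin ldE _ _) (corr-old cy) G (⊑-lin G⊑) y∈G =
  scope-minimal ldE cy G G⊑ y∈G
scope-minimal _ (corr-mulˡ cy) _ ⊑-refl _ = scope-⊑ (corr-mulˡ cy)
scope-minimal (ld-mul ldA _ _) (corr-mulˡ cy) G (⊑-mulˡ G⊑) y∈G =
  scope-minimal ldA cy G G⊑ y∈G
scope-minimal (ld-mul _ _ disj) (corr-mulˡ cy) G (⊑-mulʳ G⊑) y∈G =
  ⊥-elim (disj (corr-vars cy , ⊑-vars G⊑ y∈G))
scope-minimal _ (corr-mulʳ cy) _ ⊑-refl _ = scope-⊑ (corr-mulʳ cy)
scope-minimal (ld-mul _ _ disj) (corr-mulʳ cy) G (⊑-mulˡ G⊑) y∈G =
  ⊥-elim (disj (⊑-vars G⊑ y∈G , corr-vars cy))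
scope-minimal (ld-mul _ ldB _) (corr-mulʳ cy) G (⊑-mulʳ G⊑) y∈G =
  scope-minimal ldB cy G G⊑ y∈G

smallest-⊑ : ∀ {E y F G} → IsSmallestLDSubContaining E y F →
             IsSmallestLDSubContaining E y G → F ⊑ G
smallest-⊑ (_ , _ , _ , F-minimal) (G⊑E , ldG , y∈G , _) = F-minimal _ G⊑E ldG y∈G

scope-isSmallest : ∀ {E y q} → LowDefect E → (cy : Corr E y q) →
                   IsSmallestLDSubContaining E y (scope cy)
scope-isSmallest ld cy =
  scope-⊑ cy , ⊑-lowDefect ld (scope-⊑ cy) , ∈-scope cy ,
  λ G G⊑ _ y∈G → scope-minimal ld cy G G⊑ y∈G

∈-scope⇒descendant : ∀ {E x y p q} → LowDefect E → (cy : Corr E y q) →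
                     Corr E x p → x ∈ vars (scope cy) → DescendantOf p q
∈-scope⇒descendant _ corr-new corr-new             _ = [] , refl
∈-scope⇒descendant _ corr-new (corr-old {p = p} _) _ = p , refl
∈-scope⇒descendant (ld-lin _ x∉ _) (corr-old cy) corr-new x∈ =
  ⊥-elim (x∉ (scope-vars cy x∈))
∈-scope⇒descendant (ld-lin ldE _ _) (corr-old cy) (corr-old cx) x∈ =
  ∷-descendant (∈-scope⇒descendant ldE cy cx x∈)
∈-scope⇒descendant (ld-mul ldA _ _) (corr-mulˡ cy) (corr-mulˡ cx) x∈ =
  ∈-scope⇒descendant ldA cy cx x∈
∈-scope⇒descendant (ld-mul _ _ disj) (corr-mulˡ cy) (corr-mulʳ cx) x∈ =
  ⊥-elim (disj (scope-vars cy x∈ , corr-vars cx))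
∈-scope⇒descendant (ld-mul _ _ disj) (corr-mulʳ cy) (corr-mulˡ cx) x∈ =
  ⊥-elim (disj (corr-vars cx , scope-vars cy x∈))
∈-scope⇒descendant {E = A ⊗ _} (ld-mul _ ldB _) (corr-mulʳ cy) (corr-mulʳ cx) x∈ =
  descendant-shift (length (children (tree A))) (∈-scope⇒descendant ldB cy cx x∈)

descendant⇒∈-scope : ∀ {E x y p q} → (cy : Corr E y q) →
                     Corr E x p → DescendantOf p q → x ∈ vars (scope cy)
descendant⇒∈-scope corr-new cx _ = corr-vars cx
descendant⇒∈-scope (corr-old {p = q} cy) corr-new (r , eq) =
  ⊥-elim (corr-nonempty (subst (Corr _ _) (++-conicalˡ q r (∷-injectiveʳ eq)) cy))
descendant⇒∈-scope (corr-old cy) (corr-old cx) d =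
  descendant⇒∈-scope cy cx (∷-descendant⁻ d)
descendant⇒∈-scope (corr-mulˡ cy) (corr-mulˡ cx) d = descendant⇒∈-scope cy cx d
descendant⇒∈-scope (corr-mulˡ cy) (corr-mulʳ _) (_ , eq) =
  ⊥-elim (corr-head≢shifted cy (sym (∷-injectiveˡ eq)))
descendant⇒∈-scope (corr-mulʳ _) (corr-mulˡ cx) (_ , eq) =
  ⊥-elim (corr-head≢shifted cx (∷-injectiveˡ eq))
descendant⇒∈-scope {E = A ⊗ _} (corr-mulʳ cy) (corr-mulʳ cx) d =
  descendant⇒∈-scope cy cx (descendant-unshift (length (children (tree A))) d)

proposition3p13 : (E : Expr) → LowDefect E → (x y : Var) →
    x ∈ vars E → y ∈ vars E → (p q : Path) →
    Corr E x p → Corr E y q →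
    (x ≼[ E ] y) ⇔ DescendantOf p q
proposition3p13 E ld x y _ _ p q cx cy = mk⇔ to from
  where
  smallest : IsSmallestLDSubContaining E y (scope cy)
  smallest = scope-isSmallest ld cy

  to : x ≼[ E ] y → DescendantOf p q
  to (F , F-smallest , x∈F) =
    ∈-scope⇒descendant ld cy cx (⊑-vars (smallest-⊑ F-smallest smallest) x∈F)

  from : DescendantOf p q → x ≼[ E ] y
  from d = scope cy , smallest , descendant⇒∈-scope cy cx d
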